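{- Let $n\in\mathbb{N}$, let $A(p)$ be an $\mathcal{L}'$-formula all of whose occurrences of $p$ have depth $\leq n$, and let $C_0,\ldots,C_n$ and $D_0,\ldots,D_n$ be $\mathcal{L}$-formulas containing no free variables which are bound in $A(p)$. Then $$\mathbf{QK}\vdash\Box^{n+1}\bot\land\bigwedge_{i\leq n}\Box^{n-i}\big(\Box^{i+1}\bot\to(C_i\leftrightarrow D_i)\big)\to\big(A(p)[C_n,\ldots,C_0]\leftrightarrow A(p)[D_n,\ldots,D_0]\big).$$
   Context: Language $\mathcal{L}$: individual variables, $\top,\bot$, $\neg,\to$, $\forall$, $\Box$, countably many predicate symbols of each arity; formulas built from $\top,\bot,P(u_1,\ldots,u_n)$ by $\neg,\to,\forall u,\Box$. $\mathcal{L}'$ is $\mathcal{L}$ plus one fixed propositional variable $p$. $\Box^k A$ is $A$ prefixed by $k$ boxes ($\Box^0A=A$). The depth of an occurrence of a subformula $B$ in $A$ is the number of subformulas of $A$ of the form $\Box C$ containing that occurrence, other than $B$ itself. For an $\mathcal{L}'$-formula $A(p)$, $A(p)[B_0,\ldots,B_n]$ denotes the formula obtained by substituting $B_i$ for all occurrences of $p$ of depth $i$, for each $i\leq n$. (Thus in $A(p)[C_n,\ldots,C_0]$, $C_{n-j}$ is substituted for the occurrences of $p$ of depth $j$.) $\mathbf{QK}$: all instances of the axioms of classical first-order predicate logic and $\Box(A\to B)\to(\Box A\to\Box B)$, with rules modus ponens, generalization and necessitation. -}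

module Defs where

open import Data.Nat using (ℕ; zero; suc; _≤_; _<?_; _≡ᵇ_)
open import Data.Bool using (Bool; true; false; if_then_else_)
open import Data.Vec using (Vec)
import Data.Vec as Vec
open import Data.Vec.Membership.Propositional using (_∈_)
open import Data.Fin using (Fin; fromℕ<)
open import Data.List using (List; []; _∷_)
open import Data.Product using (_×_)
open import Data.Unit using (⊤)
open import Relation.Nullary using (¬_; yes; no)
open import Relation.Binary.PropositionalEquality using (_≡_; _≢_)

Var : Set
Var = ℕ

-- Formulas of L.  The predicate symbols of arity k are P^k_m, m : ℕ
-- (countably many of each arity); atom k m us is P^k_m(us).
data Fm : Set where
  ⊤ᶠ ⊥ᶠ : Fm
  atom  : (k m : ℕ) → Vec Var k → Fm
  ¬ᶠ_   : Fm → Fm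
  _⇒_   : Fm → Fm → Fm
  ∀ᶠ    : Var → Fm → Fm
  □     : Fm → Fm

infixr 6 _⇒_
infix 8 ¬ᶠ_

-- Formulas of L' = L plus the propositional variable p.
data FmP : Set where
  p     : FmP
  ⊤ᵖ ⊥ᵖ : FmP
  atomᵖ : (k m : ℕ) → Vec Var k → FmP
  ¬ᵖ_   : FmP → FmP
  _⇒ᵖ_  : FmP → FmP → FmP
  ∀ᵖ    : Var → FmP → FmP
  □ᵖ    : FmP → FmP

_∧ᶠ_ : Fm → Fm → Fm
A ∧ᶠ B = ¬ᶠ (A ⇒ ¬ᶠ B)

_⇔_ : Fm → Fm → Fm
A ⇔ B = (A ⇒ B) ∧ᶠ (B ⇒ A)

conj : List Fm → Fm
conj [] = ⊤ᶠ
conj (A ∷ []) = A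
conj (A ∷ B ∷ L) = A ∧ᶠ conj (B ∷ L)

□^ : ℕ → Fm → Fm
□^ zero A = A
□^ (suc k) A = □ (□^ k A)

data FreeIn (x : Var) : Fm → Set where
  atm  : ∀ {k m us} → x ∈ us → FreeIn x (atom k m us)
  neg  : ∀ {A} → FreeIn x A → FreeIn x (¬ᶠ A)
  impl : ∀ {A B} → FreeIn x A → FreeIn x (A ⇒ B)
  impr : ∀ {A B} → FreeIn x B → FreeIn x (A ⇒ B)
  all  : ∀ {u A} → u ≢ x → FreeIn x A → FreeIn x (∀ᶠ u A)
  box  : ∀ {A} → FreeIn x A → FreeIn x (□ A)

data BoundIn (x : Var) : FmP → Set where
  here : ∀ {A} → BoundIn x (∀ᵖ x A)
  all  : ∀ {u A} → BoundIn x A → BoundIn x (∀ᵖ u A)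
  neg  : ∀ {A} → BoundIn x A → BoundIn x (¬ᵖ A)
  impl : ∀ {A B} → BoundIn x A → BoundIn x (A ⇒ᵖ B)
  impr : ∀ {A B} → BoundIn x B → BoundIn x (A ⇒ᵖ B)
  box  : ∀ {A} → BoundIn x A → BoundIn x (□ᵖ A)

data OccP : FmP → ℕ → Set where
  here : OccP p 0
  neg  : ∀ {A d} → OccP A d → OccP (¬ᵖ A) d
  impl : ∀ {A B d} → OccP A d → OccP (A ⇒ᵖ B) d
  impr : ∀ {A B d} → OccP B d → OccP (A ⇒ᵖ B) d
  all  : ∀ {u A d} → OccP A d → OccP (∀ᵖ u A) d
  box  : ∀ {A d} → OccP A d → OccP (□ᵖ A) (suc d)

subP : FmP → (ℕ → Fm) → Fm
subP p σ = σ 0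
subP ⊤ᵖ σ = ⊤ᶠ
subP ⊥ᵖ σ = ⊥ᶠ
subP (atomᵖ k m us) σ = atom k m us
subP (¬ᵖ A) σ = ¬ᶠ subP A σ
subP (A ⇒ᵖ B) σ = subP A σ ⇒ subP B σ
subP (∀ᵖ u A) σ = ∀ᶠ u (subP A σ)
subP (□ᵖ A) σ = □ (subP A (λ d → σ (suc d)))

-- A(p)[B₀,…,Bₙ]: Bᵢ substituted for occurrences of p of depth i ≤ n
-- (occurrences of depth > n, excluded by the hypotheses, get ⊤).
_⟦_⟧ : ∀ {n} → FmP → (Fin (suc n) → Fm) → Fm
_⟦_⟧ {n} A B = subP A σ
  where
  σ : ℕ → Fm
  σ d with d <? suc n
  ... | yes lt = B (fromℕ< lt)
  ... | no _   = ⊤ᶠ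

renV : Var → Var → Var → Var
renV y x u = if u ≡ᵇ x then y else u

_[_/_] : Fm → Var → Var → Fm
⊤ᶠ [ y / x ] = ⊤ᶠ
⊥ᶠ [ y / x ] = ⊥ᶠ
atom k m us [ y / x ] = atom k m (Vec.map (renV y x) us)
(¬ᶠ A) [ y / x ] = ¬ᶠ (A [ y / x ])
(A ⇒ B) [ y / x ] = (A [ y / x ]) ⇒ (B [ y / x ])
∀ᶠ u A [ y / x ] = if u ≡ᵇ x then ∀ᶠ u A else ∀ᶠ u (A [ y / x ])
□ A [ y / x ] = □ (A [ y / x ])

FreeFor : Var → Var → Fm → Set
FreeFor y x ⊤ᶠ = ⊤
FreeFor y x ⊥ᶠ = ⊤
FreeFor y x (atom k m us) = ⊤
FreeFor y x (¬ᶠ A) = FreeFor y x A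
FreeFor y x (A ⇒ B) = FreeFor y x A × FreeFor y x B
FreeFor y x (∀ᶠ u A) = if u ≡ᵇ x then ⊤ else ((FreeIn x A → u ≢ y) × FreeFor y x A)
FreeFor y x (□ A) = FreeFor y x A

-- QK: Hilbert system. Classical first-order predicate logic
-- (Łukasiewicz propositional axioms, ⊤, ¬⊥, Mendelson quantifier axioms,
-- MP, Gen) plus axiom K and necessitation.
data ⊢_ : Fm → Set where
  ax1 : ∀ A B → ⊢ (A ⇒ (B ⇒ A))
  ax2 : ∀ A B C → ⊢ ((A ⇒ (B ⇒ C)) ⇒ ((A ⇒ B) ⇒ (A ⇒ C)))
  ax3 : ∀ A B → ⊢ ((¬ᶠ A ⇒ ¬ᶠ B) ⇒ (B ⇒ A))
  ax⊤ : ⊢ ⊤ᶠ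
  ax⊥ : ⊢ (¬ᶠ ⊥ᶠ)
  ax∀ : ∀ x y A → FreeFor y x A → ⊢ (∀ᶠ x A ⇒ (A [ y / x ]))
  ax∀⇒ : ∀ x A B → ¬ FreeIn x A → ⊢ (∀ᶠ x (A ⇒ B) ⇒ (A ⇒ ∀ᶠ x B))
  axK : ∀ A B → ⊢ (□ (A ⇒ B) ⇒ (□ A ⇒ □ B))
  mp  : ∀ {A B} → ⊢ (A ⇒ B) → ⊢ A → ⊢ B
  gen : ∀ {A} x → ⊢ A → ⊢ ∀ᶠ x A
  nec : ∀ {A} → ⊢ A → ⊢ □ A

infix 2 ⊢_

module Submission where

-- Write σ, τ : ℕ → Fm for the depth-indexed substitutions, and
-- Agree m σ τ for the hypotheses  □^{m+1}⊥  and  □^j (□^{m+1-j}⊥ → (σ j ↔ τ j))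
-- for j ≤ m.  We show by induction on A(p), simultaneously for all m, σ, τ, that
-- Agree m σ τ derives  A[σ] ↔ A[τ]:
--   * at p the hypothesis with j = 0 applies, its antecedent □^{m+1}⊥ being given;
--   * ¬, → and ∀ are congruences (∀ is allowed since no bound variable of A is
--     free in the substituted formulas, hence none is free in the hypotheses);
--   * at □B with m = 0 both sides follow from □⊥; with m = k+1 the hypotheses
--     for k and the shifted substitutions, once boxed, are hypotheses for m, so
--     necessitation and K lift the induction hypothesis.

open import Defs
open import Data.Nat using (ℕ; zero; suc; _≤_; _∸_; _<?_; _≡ᵇ_)
open import Data.Nat.Properties using (≡ᵇ⇒≡; ≡⇒≡ᵇ; m∸[m∸n]≡n)
open import Data.Fin using (Fin; zero; suc; toℕ; opposite)
open import Data.Fin.Properties using (toℕ<n; toℕ≤pred[n]; fromℕ<-toℕ; opposite-prop)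
open import Data.List using (List; []; _∷_; map; allFin)
open import Data.List.Membership.Propositional using (_∈_)
open import Data.List.Membership.Propositional.Properties using (∈-map⁺; ∈-map⁻; ∈-allFin)
open import Data.List.Relation.Unary.Any using (here; there)
open import Data.Product using (Σ; _×_; _,_; proj₁; proj₂)
open import Data.Sum using (_⊎_; inj₁; inj₂; [_,_])
open import Data.Bool using (true; false; T)
open import Data.Vec using (Vec)
import Data.Vec as Vec
open import Data.Unit using (tt)
open import Function using (_∘_)
open import Relation.Nullary using (¬_; yes; no; contradiction)
open import Relation.Binary.PropositionalEquality using (_≡_; refl; sym; cong; cong₂; subst; module ≡-Reasoning)

private
  variable
    Γ Δ : List Fm
    A B C D X : Fm

Fresh : Var → List Fm → Set
Fresh u Γ = ∀ {H} → H ∈ Γ → ¬ FreeIn u H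

-- Derivations in QK from the hypotheses Γ; generalisation is restricted to
-- variables fresh for Γ, which is what makes the deduction theorem hold.
data _⊩_ (Γ : List Fm) : Fm → Set where
  hyp  : A ∈ Γ → Γ ⊩ A
  thm  : ⊢ A → Γ ⊩ A
  mp⊩  : Γ ⊩ (A ⇒ B) → Γ ⊩ A → Γ ⊩ B
  gen⊩ : ∀ u → Fresh u Γ → Γ ⊩ A → Γ ⊩ ∀ᶠ u A

infix 2 _⊩_

⊢-id : ∀ A → ⊢ (A ⇒ A)
⊢-id A = mp (mp (ax2 A (A ⇒ A) A) (ax1 A (A ⇒ A))) (ax1 A A)

deduce : (A ∷ Γ) ⊩ B → Γ ⊩ (A ⇒ B)
deduce {A} (hyp (here refl)) = thm (⊢-id A)
deduce (hyp (there h)) = mp⊩ (thm (ax1 _ _)) (hyp h)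
deduce (thm t) = mp⊩ (thm (ax1 _ _)) (thm t)
deduce (mp⊩ d e) = mp⊩ (mp⊩ (thm (ax2 _ _ _)) (deduce d)) (deduce e)
deduce {A} (gen⊩ {B} u fresh d) =
  mp⊩ (thm (ax∀⇒ u A B (fresh (here refl)))) (gen⊩ u (fresh ∘ there) (deduce d))

close : [] ⊩ A → ⊢ A
close (thm t) = t
close (mp⊩ d e) = mp (close d) (close e)
close (gen⊩ u _ d) = gen u (close d)

h₀ : (A ∷ Γ) ⊩ A
h₀ = hyp (here refl)

h₁ : (B ∷ A ∷ Γ) ⊩ A
h₁ = hyp (there (here refl))

h₂ : (C ∷ B ∷ A ∷ Γ) ⊩ A
h₂ = hyp (there (there (here refl)))

h₃ : (D ∷ C ∷ B ∷ A ∷ Γ) ⊩ A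
h₃ = hyp (there (there (there (here refl))))

⊢-efq : ∀ A B → ⊢ (¬ᶠ A ⇒ (A ⇒ B))
⊢-efq A B = close (deduce (deduce (mp⊩ (mp⊩ (thm (ax3 B A)) (mp⊩ (thm (ax1 (¬ᶠ A) (¬ᶠ B))) h₁)) h₀)))

⊢-dne : ∀ A → ⊢ (¬ᶠ ¬ᶠ A ⇒ A)
⊢-dne A = close (deduce (mp⊩ (mp⊩ (thm (ax3 A (¬ᶠ ¬ᶠ A))) (mp⊩ (thm (⊢-efq (¬ᶠ A) (¬ᶠ ¬ᶠ ¬ᶠ A))) h₀)) h₀))

⊢-dni : ∀ A → ⊢ (A ⇒ ¬ᶠ ¬ᶠ A)
⊢-dni A = mp (ax3 (¬ᶠ ¬ᶠ A) A) (⊢-dne (¬ᶠ A))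

⊢-contra : ∀ A B → ⊢ ((A ⇒ B) ⇒ (¬ᶠ B ⇒ ¬ᶠ A))
⊢-contra A B = close (deduce (mp⊩ (thm (ax3 (¬ᶠ A) (¬ᶠ B)))
  (deduce (mp⊩ (thm (⊢-dni B)) (mp⊩ h₁ (mp⊩ (thm (⊢-dne A)) h₀))))))

⊢-∧-fst : ∀ A B → ⊢ (A ∧ᶠ B ⇒ A)
⊢-∧-fst A B = close (deduce (mp⊩ (thm (⊢-dne A)) (mp⊩ (mp⊩ (thm (⊢-contra _ _)) (thm (⊢-efq A (¬ᶠ B)))) h₀)))

⊢-∧-snd : ∀ A B → ⊢ (A ∧ᶠ B ⇒ B)
⊢-∧-snd A B = close (deduce (mp⊩ (thm (⊢-dne B)) (mp⊩ (mp⊩ (thm (⊢-contra _ _)) (thm (ax1 (¬ᶠ B) A))) h₀)))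

⊢-∧-intro : ∀ A B → ⊢ (A ⇒ (B ⇒ A ∧ᶠ B))
⊢-∧-intro A B = close (deduce (deduce (mp⊩ (mp⊩ (thm (⊢-contra _ _)) modusPonens) (mp⊩ (thm (⊢-dni B)) h₀))))
  where
  modusPonens : (B ∷ A ∷ []) ⊩ ((A ⇒ ¬ᶠ B) ⇒ ¬ᶠ B)
  modusPonens = deduce (mp⊩ h₀ h₂)

⊢-⇒-mono : ∀ A A′ B B′ → ⊢ ((A′ ⇒ A) ⇒ ((B ⇒ B′) ⇒ ((A ⇒ B) ⇒ (A′ ⇒ B′))))
⊢-⇒-mono A A′ B B′ = close (deduce (deduce (deduce (deduce
  (mp⊩ h₂ (mp⊩ h₁ (mp⊩ h₃ h₀)))))))

∧-intro : Γ ⊩ A → Γ ⊩ B → Γ ⊩ (A ∧ᶠ B)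
∧-intro a b = mp⊩ (mp⊩ (thm (⊢-∧-intro _ _)) a) b

∧-fst : Γ ⊩ (A ∧ᶠ B) → Γ ⊩ A
∧-fst = mp⊩ (thm (⊢-∧-fst _ _))

∧-snd : Γ ⊩ (A ∧ᶠ B) → Γ ⊩ B
∧-snd = mp⊩ (thm (⊢-∧-snd _ _))

⇒-trans : Γ ⊩ (A ⇒ B) → Γ ⊩ (B ⇒ C) → Γ ⊩ (A ⇒ C)
⇒-trans {A = A} {B} {C} f g = mp⊩ (mp⊩ (thm (ax2 A B C)) (mp⊩ (thm (ax1 (B ⇒ C) A)) g)) f

⇔-refl : Γ ⊩ (A ⇔ A)
⇔-refl = ∧-intro (thm (⊢-id _)) (thm (⊢-id _))

⇔-derivable : Γ ⊩ A → Γ ⊩ B → Γ ⊩ (A ⇔ B)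
⇔-derivable a b = ∧-intro (mp⊩ (thm (ax1 _ _)) b) (mp⊩ (thm (ax1 _ _)) a)

conj-elim : ∀ L → Γ ⊩ conj L → A ∈ L → Γ ⊩ A
conj-elim (_ ∷ []) d (here refl) = d
conj-elim (_ ∷ _ ∷ _) d (here refl) = ∧-fst d
conj-elim (_ ∷ B ∷ L) d (there h) = conj-elim (B ∷ L) (∧-snd d) h

¬-cong : Γ ⊩ (A ⇔ B) → Γ ⊩ ((¬ᶠ A) ⇔ (¬ᶠ B))
¬-cong e = ∧-intro (mp⊩ (thm (⊢-contra _ _)) (∧-snd e)) (mp⊩ (thm (⊢-contra _ _)) (∧-fst e))

⇒-cong : Γ ⊩ (A ⇔ B) → Γ ⊩ (C ⇔ D) → Γ ⊩ ((A ⇒ C) ⇔ (B ⇒ D))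
⇒-cong e f = ∧-intro (mp⊩ (mp⊩ (thm (⊢-⇒-mono _ _ _ _)) (∧-snd e)) (∧-fst f))
                     (mp⊩ (mp⊩ (thm (⊢-⇒-mono _ _ _ _)) (∧-fst e)) (∧-snd f))

□-mono : Γ ⊩ □ (A ⇒ B) → Γ ⊩ □ A → Γ ⊩ □ B
□-mono {A = A} {B} f a = mp⊩ (mp⊩ (thm (axK A B)) f) a

□-cong : Γ ⊩ □ (A ⇔ B) → Γ ⊩ (□ A ⇔ □ B)
□-cong e = ∧-intro (mp⊩ (thm (axK _ _)) (□-mono (thm (nec (⊢-∧-fst _ _))) e))
                   (mp⊩ (thm (axK _ _)) (□-mono (thm (nec (⊢-∧-snd _ _))) e))

□⊥-explodes : Γ ⊩ □ ⊥ᶠ → Γ ⊩ □ A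
□⊥-explodes = □-mono (thm (nec (mp (⊢-efq ⊥ᶠ _) ax⊥)))

renV-self : ∀ x u → renV x x u ≡ u
renV-self x u with u ≡ᵇ x in eq
... | true = sym (≡ᵇ⇒≡ u x (subst T (sym eq) tt))
... | false = refl

rename-self : ∀ X x → X [ x / x ] ≡ X
rename-self ⊤ᶠ x = refl
rename-self ⊥ᶠ x = refl
rename-self (atom k m us) x = cong (atom k m) (mapRename us)
  where
  mapRename : ∀ {k} (us : Vec Var k) → Vec.map (renV x x) us ≡ us
  mapRename Vec.[] = refl
  mapRename (u Vec.∷ us) = cong₂ Vec._∷_ (renV-self x u) (mapRename us)
rename-self (¬ᶠ X) x = cong ¬ᶠ_ (rename-self X x)
rename-self (X ⇒ Y) x = cong₂ _⇒_ (rename-self X x) (rename-self Y x)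
rename-self (∀ᶠ u X) x with u ≡ᵇ x
... | true = refl
... | false = cong (∀ᶠ u) (rename-self X x)
rename-self (□ X) x = cong □ (rename-self X x)

freeFor-self : ∀ X x → FreeFor x x X
freeFor-self ⊤ᶠ x = tt
freeFor-self ⊥ᶠ x = tt
freeFor-self (atom k m us) x = tt
freeFor-self (¬ᶠ X) x = freeFor-self X x
freeFor-self (X ⇒ Y) x = freeFor-self X x , freeFor-self Y x
freeFor-self (∀ᶠ u X) x with u ≡ᵇ x in eq
... | true = tt
... | false = (λ _ u≡x → subst T eq (≡⇒≡ᵇ u x u≡x)) , freeFor-self X x
freeFor-self (□ X) x = freeFor-self X x

⊢-∀-elim : ∀ u X → ⊢ (∀ᶠ u X ⇒ X)
⊢-∀-elim u X = subst (λ Y → ⊢ (∀ᶠ u X ⇒ Y)) (rename-self X u) (ax∀ u u X (freeFor-self X u))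

∀-mono : ∀ u → Fresh u Γ → Γ ⊩ (A ⇒ B) → Γ ⊩ (∀ᶠ u A ⇒ ∀ᶠ u B)
∀-mono {A = A} {B} u fresh f =
  mp⊩ (thm (ax∀⇒ u (∀ᶠ u A) B bound)) (gen⊩ u fresh (⇒-trans (thm (⊢-∀-elim u A)) f))
  where
  bound : ¬ FreeIn u (∀ᶠ u A)
  bound (all u≢u _) = u≢u refl

∀-cong : ∀ u → Fresh u Γ → Γ ⊩ (A ⇔ B) → Γ ⊩ (∀ᶠ u A ⇔ ∀ᶠ u B)
∀-cong u fresh e = ∧-intro (∀-mono u fresh (∧-fst e)) (∀-mono u fresh (∧-snd e))

Curried : List Fm → Fm → Fm
Curried [] X = X
Curried (H ∷ Γ) X = Curried Γ (H ⇒ X)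

close-all : Γ ⊩ X → ⊢ Curried Γ X
close-all {[]} d = close d
close-all {_ ∷ _} d = close-all (deduce d)

cut : Γ ⊩ X → (∀ {H} → H ∈ Γ → Δ ⊩ H) → Δ ⊩ X
cut {Γ} d hs = discharge Γ (thm (close-all d)) hs
  where
  discharge : ∀ Γ {X} → Δ ⊩ Curried Γ X → (∀ {H} → H ∈ Γ → Δ ⊩ H) → Δ ⊩ X
  discharge [] d hs = d
  discharge (H ∷ Γ) d hs = mp⊩ (discharge Γ d (hs ∘ there)) (hs (here refl))

cut-□ : Γ ⊩ X → (∀ {H} → H ∈ Γ → Δ ⊩ □ H) → Δ ⊩ □ X
cut-□ {Γ} d hs = discharge Γ (thm (nec (close-all d))) hs
  where
  discharge : ∀ Γ {X} → Δ ⊩ □ (Curried Γ X) → (∀ {H} → H ∈ Γ → Δ ⊩ □ H) → Δ ⊩ □ X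
  discharge [] d hs = d
  discharge (H ∷ Γ) d hs = □-mono (discharge Γ d (hs ∘ there)) (hs (here refl))

agreeAt : ℕ → (σ τ : ℕ → Fm) → ℕ → Fm
agreeAt m σ τ j = □^ j (□^ (suc (m ∸ j)) ⊥ᶠ ⇒ (σ j ⇔ τ j))

Agree : ℕ → (σ τ : ℕ → Fm) → List Fm
Agree m σ τ = □^ (suc m) ⊥ᶠ ∷ map (agreeAt m σ τ ∘ toℕ) (allFin (suc m))

agreeAt∈Agree : ∀ {m} (σ τ : ℕ → Fm) (i : Fin (suc m)) → agreeAt m σ τ (toℕ i) ∈ Agree m σ τ
agreeAt∈Agree σ τ i = there (∈-map⁺ _ (∈-allFin i))

-- Boxing the hypotheses for m and the shifted substitutions gives hypotheses
-- for m + 1 (definitionally, since suc m ∸ suc j = m ∸ j).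
Agree-shift : ∀ m (σ τ : ℕ → Fm) {H} → H ∈ Agree m (σ ∘ suc) (τ ∘ suc) → Agree (suc m) σ τ ⊩ □ H
Agree-shift m σ τ (here refl) = hyp (here refl)
Agree-shift m σ τ (there h) with ∈-map⁻ _ h
... | i , _ , refl = hyp (agreeAt∈Agree σ τ (suc i))

free-□^ : ∀ {u} k → FreeIn u (□^ k X) → FreeIn u X
free-□^ zero f = f
free-□^ (suc k) (box f) = free-□^ k f

closed-□^⊥ : ∀ {u} k → ¬ FreeIn u (□^ k ⊥ᶠ)
closed-□^⊥ k f with free-□^ k f
... | ()

free-⇔ : ∀ {u} → FreeIn u (A ⇔ B) → FreeIn u A ⊎ FreeIn u B
free-⇔ (neg (impl (impl f))) = inj₁ f
free-⇔ (neg (impl (impr f))) = inj₂ f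
free-⇔ (neg (impr (neg (impl f)))) = inj₂ f
free-⇔ (neg (impr (neg (impr f)))) = inj₁ f

Agree-fresh : ∀ {u} m (σ τ : ℕ → Fm)
  → (∀ (i : Fin (suc m)) → ¬ FreeIn u (σ (toℕ i)) × ¬ FreeIn u (τ (toℕ i)))
  → Fresh u (Agree m σ τ)
Agree-fresh m σ τ fresh (here refl) = closed-□^⊥ (suc m)
Agree-fresh m σ τ fresh (there h) f with ∈-map⁻ _ h
... | i , _ , refl with free-□^ (toℕ i) f
...   | impl g = closed-□^⊥ (suc (m ∸ toℕ i)) g
...   | impr g = [ proj₁ (fresh i) , proj₂ (fresh i) ] (free-⇔ g)

Substitutable : ℕ → (σ τ : ℕ → Fm) → FmP → Set
Substitutable m σ τ A =
  ∀ (i : Fin (suc m)) {u} → BoundIn u A → ¬ FreeIn u (σ (toℕ i)) × ¬ FreeIn u (τ (toℕ i))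

agree-⇔ : ∀ m (A : FmP) (σ τ : ℕ → Fm) → Substitutable m σ τ A
  → Agree m σ τ ⊩ (subP A σ ⇔ subP A τ)
agree-⇔ m p σ τ ok = mp⊩ (hyp (agreeAt∈Agree σ τ zero)) (hyp (here refl))
agree-⇔ m ⊤ᵖ σ τ ok = ⇔-refl
agree-⇔ m ⊥ᵖ σ τ ok = ⇔-refl
agree-⇔ m (atomᵖ k l us) σ τ ok = ⇔-refl
agree-⇔ m (¬ᵖ A) σ τ ok = ¬-cong (agree-⇔ m A σ τ (λ i → ok i ∘ neg))
agree-⇔ m (A ⇒ᵖ B) σ τ ok =
  ⇒-cong (agree-⇔ m A σ τ (λ i → ok i ∘ impl)) (agree-⇔ m B σ τ (λ i → ok i ∘ impr))
agree-⇔ m (∀ᵖ u A) σ τ ok =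
  ∀-cong u (Agree-fresh m σ τ (λ i → ok i here)) (agree-⇔ m A σ τ (λ i → ok i ∘ all))
agree-⇔ zero (□ᵖ A) σ τ ok =
  ⇔-derivable (□⊥-explodes (hyp (here refl))) (□⊥-explodes (hyp (here refl)))
agree-⇔ (suc m) (□ᵖ A) σ τ ok =
  □-cong (cut-□ (agree-⇔ m A (σ ∘ suc) (τ ∘ suc) (λ i → ok (suc i) ∘ box))
                (Agree-shift m σ τ))

-- The depth-indexed substitution performed by A ⟦ B ⟧ (the local σ of its
-- definition, recovered by unification); it places B i at depth toℕ i.
depthSubst : ∀ {n} (A : FmP) (B : Fin (suc n) → Fm) → ℕ → Fm
depthSubst A B = proj₁ underlying
  where
  underlying : Σ (ℕ → Fm) λ σ → A ⟦ B ⟧ ≡ subP A σ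
  underlying = _ , refl

depthSubst-at : ∀ {n} (A : FmP) (B : Fin (suc n) → Fm) (i : Fin (suc n)) → depthSubst A B (toℕ i) ≡ B i
depthSubst-at {n} A B i with toℕ i <? suc n
... | yes lt = cong B (fromℕ<-toℕ i lt)
... | no ¬lt = contradiction (toℕ<n i) ¬lt

statementHyp : ∀ n (C D : Fin (suc n) → Fm) → Fin (suc n) → Fm
statementHyp n C D k = □^ (n ∸ toℕ k) (□^ (suc (toℕ k)) ⊥ᶠ ⇒ (C k ⇔ D k))

statementHyps : ∀ n (C D : Fin (suc n) → Fm) → List Fm
statementHyps n C D = □^ (suc n) ⊥ᶠ ∷ map (statementHyp n C D) (allFin (suc n))

statementHyp-opposite : ∀ n (σ τ : ℕ → Fm) (C D : Fin (suc n) → Fm)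
  → (∀ i → σ (toℕ i) ≡ C (opposite i)) → (∀ i → τ (toℕ i) ≡ D (opposite i))
  → ∀ i → statementHyp n C D (opposite i) ≡ agreeAt n σ τ (toℕ i)
statementHyp-opposite n σ τ C D σ-at τ-at i = begin
  □^ (n ∸ toℕ (opposite i)) (□^ (suc (toℕ (opposite i))) ⊥ᶠ ⇒ (C (opposite i) ⇔ D (opposite i)))
    ≡⟨ cong (λ k → □^ (n ∸ k) (□^ (suc k) ⊥ᶠ ⇒ (C (opposite i) ⇔ D (opposite i)))) (opposite-prop i) ⟩
  □^ (n ∸ (n ∸ toℕ i)) (□^ (suc (n ∸ toℕ i)) ⊥ᶠ ⇒ (C (opposite i) ⇔ D (opposite i)))
    ≡⟨ cong (λ k → □^ k (□^ (suc (n ∸ toℕ i)) ⊥ᶠ ⇒ (C (opposite i) ⇔ D (opposite i)))) (m∸[m∸n]≡n (toℕ≤pred[n] i)) ⟩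
  □^ (toℕ i) (□^ (suc (n ∸ toℕ i)) ⊥ᶠ ⇒ (C (opposite i) ⇔ D (opposite i)))
    ≡⟨ sym (cong₂ (λ X Y → □^ (toℕ i) (□^ (suc (n ∸ toℕ i)) ⊥ᶠ ⇒ (X ⇔ Y))) (σ-at i) (τ-at i)) ⟩
  agreeAt n σ τ (toℕ i) ∎
  where open ≡-Reasoning

statementHyps⊩Agree : ∀ n (σ τ : ℕ → Fm) (C D : Fin (suc n) → Fm)
  → (∀ i → σ (toℕ i) ≡ C (opposite i)) → (∀ i → τ (toℕ i) ≡ D (opposite i))
  → ∀ {H} → H ∈ Agree n σ τ → (conj (statementHyps n C D) ∷ []) ⊩ H
statementHyps⊩Agree n σ τ C D σ-at τ-at (here refl) = conj-elim (statementHyps n C D) h₀ (here refl)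
statementHyps⊩Agree n σ τ C D σ-at τ-at (there h) with ∈-map⁻ _ h
... | i , _ , refl =
  subst (λ H → (conj (statementHyps n C D) ∷ []) ⊩ H) (statementHyp-opposite n σ τ C D σ-at τ-at i)
        (conj-elim (statementHyps n C D) h₀ (there (∈-map⁺ _ (∈-allFin (opposite i)))))

-- Lemma 4.5.
lemma4p5 : (n : ℕ) (A : FmP) (C D : Fin (suc n) → Fm)
    → (∀ d → OccP A d → d ≤ n)
    → (∀ i u → FreeIn u (C i) → ¬ BoundIn u A)
    → (∀ i u → FreeIn u (D i) → ¬ BoundIn u A)
    → ⊢ (conj (□^ (suc n) ⊥ᶠ ∷ map (λ i → □^ (n ∸ toℕ i) (□^ (suc (toℕ i)) ⊥ᶠ ⇒ (C i ⇔ D i))) (allFin (suc n)))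
          ⇒ ((A ⟦ C ∘ opposite ⟧) ⇔ (A ⟦ D ∘ opposite ⟧)))
lemma4p5 n A C D _ freeC freeD =
  close (deduce (cut (agree-⇔ n A σ τ substitutable) (statementHyps⊩Agree n σ τ C D σ-at τ-at)))
  where
  σ τ : ℕ → Fm
  σ = depthSubst A (C ∘ opposite)
  τ = depthSubst A (D ∘ opposite)
  σ-at : ∀ i → σ (toℕ i) ≡ C (opposite i)
  σ-at = depthSubst-at A (C ∘ opposite)
  τ-at : ∀ i → τ (toℕ i) ≡ D (opposite i)
  τ-at = depthSubst-at A (D ∘ opposite)
  substitutable : Substitutable n σ τ A
  substitutable i {u} bound =
    (λ f → freeC (opposite i) u (subst (FreeIn u) (σ-at i) f) bound) ,
    (λ f → freeD (opposite i) u (subst (FreeIn u) (τ-at i) f) bound)
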